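{- Let $\mathcal{A}$ be a DMF-algebra and $\overline{v}$ a partial valuation on $\mathcal{A}$. Then for all $a\in A$: (1) $\overline{v}(1)=(1,0)$; (2) $\overline{v}(n)=(0,0)$; (3) if $a\le n$ then $\overline{v}(a)\preccurlyeq(0,0)$; (4) $\overline{v}(a)=\overline{v}(a\wedge n)+\overline{v}(a\vee n)$; (5) $\overline{v}(a)=(\overline{v}(a\vee n)_0,\overline{v}(\lnot a\vee n)_0)$, where $(x,y)_0=x$.
   Context: A DMF-algebra is an algebra $(A,\wedge,\vee,\lnot,0,1,n)$ such that $(A,\wedge,\vee,0,1)$ is a bounded distributive lattice, $\lnot\lnot x=x$, $\lnot(x\wedge y)=\lnot x\vee\lnot y$, $x\wedge\lnot x\le y\vee\lnot y$, and $\lnot n=n$. Let $T=\{(x,y)\in[0,1]^2: x+y\le1\}$ ordered by $(x,y)\preccurlyeq(w,z)$ iff $x\le w$ and $z\le y$; addition and subtraction of pairs are componentwise in $\mathbb{R}^2$; $\sigma(x,y)=(y,x)$. A partial valuation on $\mathcal{A}$ is a map $\overline{v}:A\to T$ with: (i) $\overline{v}(0)=(0,1)$; (ii) $\overline{v}(a\vee b)=\overline{v}(a)+\overline{v}(b)-\overline{v}(a\wedge b)$; (iii) $\overline{v}(\lnot a)=\sigma(\overline{v}(a))$; (iv) if $n\le a$ then $(0,0)\preccurlyeq\overline{v}(a)$. -}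

module Defs where

open import Data.Product using (Σ; _×_; _,_; proj₁; proj₂)
open import Relation.Binary.PropositionalEquality using (_≡_)
open import Relation.Nullary using (¬_)
open import Relation.Binary.Structures using (IsTotalOrder)
open import Algebra.Structures using (IsCommutativeRing)
open import Algebra.Lattice.Structures using (IsDistributiveLattice)

-- Scalars: an arbitrary ordered field (the paper uses ℝ, which is one).

record OrderedField : Set₁ where
  infixl 6 _+_ _-_
  infixl 7 _*_
  infix 4 _≤_
  field
    R   : Set
    _+_ _*_ : R → R → R
    -_  : R → R
    0# 1# : R
    _≤_ : R → R → Set
    isCommutativeRing : IsCommutativeRing _≡_ _+_ _*_ -_ 0# 1#
    isTotalOrder      : IsTotalOrder _≡_ _≤_
    0≢1       : ¬ (0# ≡ 1#)
    inverse   : ∀ x → ¬ (x ≡ 0#) → Σ R (λ y → x * y ≡ 1#)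
    +-mono-≤  : ∀ {x y} z → x ≤ y → x + z ≤ y + z
    *-nonneg  : ∀ {x y} → 0# ≤ x → 0# ≤ y → 0# ≤ x * y

  _-_ : R → R → R
  x - y = x + (- y)

record DMFAlgebra : Set₁ where
  infixr 7 _∧_
  infixr 6 _∨_
  infix 4 _≤_
  infix 8 ∼_
  field
    A     : Set
    _∧_ _∨_ : A → A → A
    ∼_    : A → A
    0a 1a n : A
    isDistributiveLattice : IsDistributiveLattice _≡_ _∨_ _∧_
    ∨-identityˡ : ∀ x → 0a ∨ x ≡ x
    ∧-identityˡ : ∀ x → 1a ∧ x ≡ x
    ¬-involutive : ∀ x → ∼ (∼ x) ≡ x
    deMorgan     : ∀ x y → ∼ (x ∧ y) ≡ (∼ x) ∨ (∼ y)
    kleene       : ∀ x y → (x ∧ ∼ x) ∧ (y ∨ ∼ y) ≡ x ∧ ∼ x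
    ∼n≡n         : ∼ n ≡ n

  _≤_ : A → A → Set
  a ≤ b = a ∧ b ≡ a

module Pairs (F : OrderedField) where
  open OrderedField F

  InT : R × R → Set
  InT (x , y) = (0# ≤ x) × (x ≤ 1#) × (0# ≤ y) × (y ≤ 1#) × (x + y ≤ 1#)

  _≼_ : R × R → R × R → Set
  (x , y) ≼ (w , z) = (x ≤ w) × (z ≤ y)

  _⊕_ : R × R → R × R → R × R
  (x , y) ⊕ (w , z) = (x + w , y + z)

  _⊖_ : R × R → R × R → R × R
  (x , y) ⊖ (w , z) = (x - w , y - z)

  σ : R × R → R × R
  σ (x , y) = (y , x)

  first : R × R → R
  first = proj₁

record PartialValuation (F : OrderedField) (𝒜 : DMFAlgebra) : Set where
  open OrderedField F using (R; 0#; 1#)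
  open DMFAlgebra 𝒜
  open Pairs F
  field
    v     : A → R × R
    v∈T   : ∀ a → InT (v a)
    v-0   : v 0a ≡ (0# , 1#)
    v-∨   : ∀ a b → v (a ∨ b) ≡ (v a ⊕ v b) ⊖ v (a ∧ b)
    v-¬   : ∀ a → v (∼ a) ≡ σ (v a)
    v-n   : ∀ a → n ≤ a → (0# , 0#) ≼ v a

module _ (F : OrderedField) (𝒜 : DMFAlgebra) (V : PartialValuation F 𝒜) where
  open OrderedField F using (0#; 1#)
  open DMFAlgebra 𝒜
  open Pairs F
  open PartialValuation V using (v)

  Theorem10Conclusion : Set
  Theorem10Conclusion =
      (v 1a ≡ (1# , 0#))
    × (v n ≡ (0# , 0#))
    × (∀ a → a ≤ n → v a ≼ (0# , 0#))
    × (∀ a → v a ≡ v (a ∧ n) ⊕ v (a ∨ n))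
    × (∀ a → v a ≡ (first (v (a ∨ n)) , first (v (∼ a ∨ n))))

-- v 1 = σ (v 0), and since n is self-dual, v n = σ (v n) lies both above and below (0 , 0): (1), (2).
-- For a ≤ n, antitonicity of ∼ gives n ≤ ∼ a, and axiom (iv) for ∼ a read through σ is (3).
-- With v n = (0 , 0) the modular law for a and n becomes (4); by (3) and v (a ∧ n) ∈ T the first
-- coordinate of v (a ∧ n) vanishes, so v a and v (a ∨ n) share their first coordinate, while the
-- second coordinate of v a is the first of v (∼ a): (5).
module Submission where

open import Defs
open import Level using (0ℓ)
open import Data.Product using (_,_; proj₁; swap)
open import Relation.Binary.PropositionalEquality using (_≡_; sym; trans; subst; cong; cong₂; module ≡-Reasoning)
open import Relation.Binary.Structures using (IsTotalOrder)
open import Algebra.Bundles using (CommutativeRing)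
open import Algebra.Lattice.Bundles using (DistributiveLattice)
import Algebra.Properties.AbelianGroup as AbelianGroupProperties
import Algebra.Lattice.Properties.Lattice as LatticeProperties

module DMFAlgebraProperties (𝒜 : DMFAlgebra) where
  open DMFAlgebra 𝒜

  distributiveLattice : DistributiveLattice 0ℓ 0ℓ
  distributiveLattice = record { isDistributiveLattice = isDistributiveLattice }

  open DistributiveLattice distributiveLattice
    using (∨-comm; ∧-assoc; ∨-absorbs-∧; ∧-absorbs-∨; lattice)
  open LatticeProperties lattice using (∧-idem)
  open ≡-Reasoning

  ∧-zeroˡ : ∀ x → 0a ∧ x ≡ 0a
  ∧-zeroˡ x = begin
    0a ∧ x          ≡⟨ cong (0a ∧_) (sym (∨-identityˡ x)) ⟩
    0a ∧ (0a ∨ x)   ≡⟨ ∧-absorbs-∨ 0a x ⟩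
    0a              ∎

  ∨-zeroʳ : ∀ x → x ∨ 1a ≡ 1a
  ∨-zeroʳ x = begin
    x ∨ 1a          ≡⟨ ∨-comm x 1a ⟩
    1a ∨ x          ≡⟨ cong (1a ∨_) (sym (∧-identityˡ x)) ⟩
    1a ∨ (1a ∧ x)   ≡⟨ ∨-absorbs-∧ 1a x ⟩
    1a              ∎

  ∼0≡1 : ∼ 0a ≡ 1a
  ∼0≡1 = begin
    ∼ 0a                ≡⟨ cong ∼_ (sym (∧-zeroˡ (∼ 1a))) ⟩
    ∼ (0a ∧ ∼ 1a)       ≡⟨ deMorgan 0a (∼ 1a) ⟩
    ∼ 0a ∨ ∼ (∼ 1a)     ≡⟨ cong (∼ 0a ∨_) (¬-involutive 1a) ⟩
    ∼ 0a ∨ 1a           ≡⟨ ∨-zeroʳ (∼ 0a) ⟩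
    1a                  ∎

  ≤-refl : ∀ x → x ≤ x
  ≤-refl = ∧-idem

  x∧y≤y : ∀ x y → x ∧ y ≤ y
  x∧y≤y x y = trans (∧-assoc x y y) (cong (x ∧_) (∧-idem y))

  ∼-antitone : ∀ {x y} → x ≤ y → ∼ y ≤ ∼ x
  ∼-antitone {x} {y} x≤y = begin
    ∼ y ∧ ∼ x           ≡⟨ cong (λ z → ∼ y ∧ ∼ z) (sym x≤y) ⟩
    ∼ y ∧ ∼ (x ∧ y)     ≡⟨ cong (∼ y ∧_) (trans (deMorgan x y) (∨-comm (∼ x) (∼ y))) ⟩
    ∼ y ∧ (∼ y ∨ ∼ x)   ≡⟨ ∧-absorbs-∨ (∼ y) (∼ x) ⟩
    ∼ y                 ∎

  ≤n⇒n≤∼ : ∀ {x} → x ≤ n → n ≤ ∼ x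
  ≤n⇒n≤∼ {x} x≤n = trans (cong (_∧ ∼ x) (sym ∼n≡n)) (trans (∼-antitone x≤n) ∼n≡n)

module PairsProperties (F : OrderedField) where
  open OrderedField F renaming (_≤_ to _≤F_)
  open Pairs F
  open IsTotalOrder isTotalOrder using (antisym)

  commutativeRing : CommutativeRing 0ℓ 0ℓ
  commutativeRing = record { isCommutativeRing = isCommutativeRing }

  open CommutativeRing commutativeRing using (+-assoc; +-identityˡ; +-identityʳ; +-abelianGroup)
  open AbelianGroupProperties +-abelianGroup using (xyx⁻¹≈y)

  ⊕-identityʳ : ∀ p → p ⊕ (0# , 0#) ≡ p
  ⊕-identityʳ (x , y) = cong₂ _,_ (+-identityʳ x) (+-identityʳ y)

  ⊕-⊖-cancel : ∀ p q → q ⊕ (p ⊖ q) ≡ p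
  ⊕-⊖-cancel (x , y) (w , z) = cong₂ _,_ (cancel w x) (cancel z y)
    where
    cancel : ∀ a b → a + (b - a) ≡ b
    cancel a b = trans (sym (+-assoc a b (- a))) (xyx⁻¹≈y a b)

  ≼σ-sym : ∀ {p q} → p ≼ σ q → q ≼ σ p
  ≼σ-sym = swap

  σ-fixed-nonneg⇒0 : ∀ {p} → σ p ≡ p → (0# , 0#) ≼ p → p ≡ (0# , 0#)
  σ-fixed-nonneg⇒0 {x , y} σp≡p (0≤x , y≤0) = cong₂ _,_ x≡0 (trans (sym x≡y) x≡0)
    where
    x≡y : x ≡ y
    x≡y = sym (cong proj₁ σp≡p)

    x≡0 : x ≡ 0#
    x≡0 = antisym (subst (_≤F 0#) (sym x≡y) y≤0) 0≤x

  first-≼0 : ∀ {p} → InT p → p ≼ (0# , 0#) → first p ≡ 0#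
  first-≼0 (0≤x , _) (x≤0 , _) = antisym x≤0 0≤x

module PartialValuationProperties (F : OrderedField) (𝒜 : DMFAlgebra) (V : PartialValuation F 𝒜) where
  open OrderedField F using (0#; 1#; _+_)
  open DMFAlgebra 𝒜
  open Pairs F
  open PartialValuation V
  open DMFAlgebraProperties 𝒜
  open PairsProperties F
  open CommutativeRing commutativeRing using (+-identityˡ)
  open ≡-Reasoning

  v-1 : v 1a ≡ (1# , 0#)
  v-1 = begin
    v 1a        ≡⟨ cong v (sym ∼0≡1) ⟩
    v (∼ 0a)    ≡⟨ v-¬ 0a ⟩
    σ (v 0a)    ≡⟨ cong σ v-0 ⟩
    (1# , 0#)   ∎

  v-n≡0 : v n ≡ (0# , 0#)
  v-n≡0 = σ-fixed-nonneg⇒0 (trans (sym (v-¬ n)) (cong v ∼n≡n)) (v-n n (≤-refl n))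

  v-≤n : ∀ a → a ≤ n → v a ≼ (0# , 0#)
  v-≤n a a≤n = ≼σ-sym (subst ((0# , 0#) ≼_) (v-¬ a) (v-n (∼ a) (≤n⇒n≤∼ a≤n)))

  v-∨n : ∀ a → v (a ∨ n) ≡ v a ⊖ v (a ∧ n)
  v-∨n a = begin
    v (a ∨ n)                         ≡⟨ v-∨ a n ⟩
    (v a ⊕ v n) ⊖ v (a ∧ n)           ≡⟨ cong (λ p → (v a ⊕ p) ⊖ v (a ∧ n)) v-n≡0 ⟩
    (v a ⊕ (0# , 0#)) ⊖ v (a ∧ n)     ≡⟨ cong (_⊖ v (a ∧ n)) (⊕-identityʳ (v a)) ⟩
    v a ⊖ v (a ∧ n)                   ∎

  v-split : ∀ a → v a ≡ v (a ∧ n) ⊕ v (a ∨ n)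
  v-split a = sym (begin
    v (a ∧ n) ⊕ v (a ∨ n)             ≡⟨ cong (v (a ∧ n) ⊕_) (v-∨n a) ⟩
    v (a ∧ n) ⊕ (v a ⊖ v (a ∧ n))     ≡⟨ ⊕-⊖-cancel (v a) (v (a ∧ n)) ⟩
    v a                               ∎)

  first-v-∨n : ∀ a → first (v (a ∨ n)) ≡ first (v a)
  first-v-∨n a = sym (begin
    first (v a)                                   ≡⟨ cong first (v-split a) ⟩
    first (v (a ∧ n)) + first (v (a ∨ n))         ≡⟨ cong (_+ first (v (a ∨ n))) first-v-∧n ⟩
    0# + first (v (a ∨ n))                        ≡⟨ +-identityˡ _ ⟩
    first (v (a ∨ n))                             ∎)
    where
    first-v-∧n : first (v (a ∧ n)) ≡ 0#
    first-v-∧n = first-≼0 (v∈T (a ∧ n)) (v-≤n (a ∧ n) (x∧y≤y a n))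

  v-coordinates : ∀ a → v a ≡ (first (v (a ∨ n)) , first (v (∼ a ∨ n)))
  v-coordinates a = begin
    v a                                           ≡⟨⟩
    (first (v a) , first (σ (v a)))               ≡⟨ cong (λ p → first (v a) , first p) (sym (v-¬ a)) ⟩
    (first (v a) , first (v (∼ a)))               ≡⟨ sym (cong₂ _,_ (first-v-∨n a) (first-v-∨n (∼ a))) ⟩
    (first (v (a ∨ n)) , first (v (∼ a ∨ n)))     ∎

mainTheorem10 : (F : OrderedField) (𝒜 : DMFAlgebra) (V : PartialValuation F 𝒜) →
    Theorem10Conclusion F 𝒜 V
mainTheorem10 F 𝒜 V = v-1 , v-n≡0 , v-≤n , v-split , v-coordinates
  where open PartialValuationProperties F 𝒜 V
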